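{- Let $\mathcal{T}$ be a tanglegram having exactly one cross-responsible set $X$, and assume $\mathcal{T}[X]$ is isomorphic to $\mathcal{K}_1$. Then every $m\in\sigma_{\mathcal{T}}\setminus X$ has at least one outside scar in $\mathcal{T}[X]$.
   Context: A rooted tree is a tree with at least two vertices and a designated root of degree $1$; leaves are non-root vertices of degree $1$; a rooted binary tree is a rooted tree in which all non-root, non-leaf vertices have degree $3$. For a set $S$ of leaves of a rooted binary tree $T$, $T\llbracket S\rrbracket$ is the union of the root-to-$s$ paths for $s\in S$, and $T[S]$ is obtained from $T\llbracket S\rrbracket$ by suppressing degree-$2$ vertices; each edge $e$ of $T[S]$ corresponds to a path $P_e$ of $T\llbracket S\rrbracket$. For a leaf $w\notin S$, the scar of $w$ in $T[S]$ is on edge $e$ if the first vertex of $T\llbracket S\rrbracket$ met by the path from $w$ to the root is an interior vertex of $P_e$. A tanglegram $\mathcal{T}=(L_{\mathcal{T}},R_{\mathcal{T}},\sigma_{\mathcal{T}})$ consists of two rooted binary trees with equally many leaves and a perfect matching $\sigma_{\mathcal{T}}$ between their leaf sets. For $Z\subseteq\sigma_{\mathcal{T}}$, $\mathcal{T}[Z]$ has left tree $L_{\mathcal{T}}[S_1]$, right tree $R_{\mathcal{T}}[S_2]$ and matching $Z$, where $S_1,S_2$ are the left and right leaves covered by $Z$. Tanglegrams are isomorphic if there is a graph isomorphism mapping left root to left root and right root to right root. For $m\in\sigma_{\mathcal{T}}\setminus Z$ with left endpoint $\mu_1$ and right endpoint $\mu_2$, its left-scar in $\mathcal{T}[Z]$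 is the scar of $\mu_1$ in $L_{\mathcal{T}}[S_1]$ and its right-scar is the scar of $\mu_2$ in $R_{\mathcal{T}}[S_2]$. A scar is an outside scar if it lies on a root-edge (the edge incident to the root), and an inside scar otherwise. $\mathcal{K}_1$ is the size-$4$ tanglegram in which each tree has root adjacent to an internal vertex whose two children each have two leaf children, with left cherries $\{l_1,l_2\},\{l_3,l_4\}$, right cherries $\{r_1,r_2\},\{r_3,r_4\}$ and matching $l_1r_1, l_2r_3, l_3r_2, l_4r_4$. $\mathcal{K}_2$ is the size-$4$ tanglegram whose left tree is: root adjacent to $v_1$, $v_1$ has children leaf $l_1$ and $v_2$, $v_2$ has children leaf $l_2$ and $v_3$, $v_3$ has leaf children $l_3,l_4$; right tree analogously with $w_1,w_2,w_3$ and leaves $r_1$ (child of $w_1$), $r_2$ (child of $w_2$), $r_3,r_4$ (children of $w_3$); matching $l_1r_4, l_2r_2, l_3r_3, l_4r_1$. A set $Y\subseteq\sigma_{\mathcal{T}}$ is cross-responsible if $\mathcal{T}[Y]$ is isomorphic to $\mathcal{K}_1$ or $\mathcal{K}_2$. -}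

module Defs where

open import Data.Bool using (Bool; true; false; if_then_else_; _∧_; _∨_)
open import Data.Nat using (ℕ)
open import Data.Fin using (Fin; zero; suc)
open import Data.Fin.Properties using (_≟_)
open import Data.Fin.Subset using (Subset)
open import Data.Vec using (lookup)
open import Data.List using (List; []; _∷_; _++_)
open import Data.Bool.ListAction using (any)
open import Data.List.Membership.Propositional using (_∈_)
open import Data.List.Relation.Unary.Unique.Propositional using (Unique)
open import Data.Maybe using (Maybe; just; nothing)
import Data.Maybe as Maybe
open import Data.Product using (Σ; _×_; _,_; ∃)
open import Data.Sum using (_⊎_)
open import Relation.Nullary.Decidable using (⌊_⌋)
open import Relation.Binary.PropositionalEquality using (_≡_)

-- A rooted binary tree (root of degree 1, internal vertices of degree 3)
-- is determined by the full binary tree hanging below the root's unique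
-- neighbour.  The left/right order of children is
-- an artefact of the encoding; isomorphism (below) ignores it.

data BT (A : Set) : Set where
  lf : A → BT A
  nd : BT A → BT A → BT A

leaves : {A : Set} → BT A → List A
leaves (lf a)   = a ∷ []
leaves (nd l r) = leaves l ++ leaves r

-- The matching edges are identified with Fin n:
-- the left leaf labelled i is matched with the right leaf labelled i.

IsLeafBijection : (n : ℕ) → BT (Fin n) → Set
IsLeafBijection n t = Unique (leaves t) × (∀ i → i ∈ leaves t)

record Tanglegram (n : ℕ) : Set where
  field
    left      : BT (Fin n)
    right     : BT (Fin n)
    left-ok   : IsLeafBijection n left
    right-ok  : IsLeafBijection n right
open Tanglegram public

-- Induced subtree T[S]: keep the root-to-leaf paths for leaves in S
-- and suppress degree-2 vertices.  Result is nothing iff S misses t.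

restrict : {n : ℕ} → (Fin n → Bool) → BT (Fin n) → Maybe (BT (Fin n))
restrict S (lf a) = if S a then just (lf a) else nothing
restrict S (nd l r) with restrict S l | restrict S r
... | just l' | just r' = just (nd l' r')
... | just l' | nothing = just l'
... | nothing | just r' = just r'
... | nothing | nothing = nothing

hasS : {n : ℕ} → (Fin n → Bool) → BT (Fin n) → Bool
hasS S t = any S (leaves t)

occurs : {n : ℕ} → Fin n → BT (Fin n) → Bool
occurs w t = any (λ x → ⌊ x ≟ w ⌋) (leaves t)

-- Edges of T[S] are named by their lower endpoint, given as an address
-- (list of directions) from the top vertex of T[S]; the root-edge of
-- T[S] (the edge incident to the root) has address [].

data Dir : Set where
  L R : Dir

Address : Set
Address = List Dir

-- scar S w t : the edge of t[S] carrying the scar of leaf w (w ∉ S),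
-- i.e. the edge e such that the first vertex of t⟦S⟧ met on the path
-- from w to the root is an interior vertex of P_e.  Addresses are
-- relative to the restriction of the current subtree, whose top edge
-- is [].  nothing if w does not occur (or S misses t).
scar : {n : ℕ} → (Fin n → Bool) → Fin n → BT (Fin n) → Maybe Address
scar S w (lf a) = nothing
scar S w (nd l r) with hasS S l | hasS S r
... | true  | true  =
  if occurs w l then Maybe.map (L ∷_) (scar S w l)
  else if occurs w r then Maybe.map (R ∷_) (scar S w r)
  else nothing
... | true  | false =
  -- this vertex is suppressed: it lies inside the edge above the top of l[S]
  if occurs w r then just [] else scar S w l
... | false | true  =
  if occurs w l then just [] else scar S w r
... | false | false = nothing

-- a scar is an outside scar iff it lies on the root-edge
IsOutside : Maybe Address → Set
IsOutside s = s ≡ just []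

data TIso {A B : Set} (f : A → B) : BT A → BT B → Set where
  lf   : ∀ a → TIso f (lf a) (lf (f a))
  nd   : ∀ {l r l' r'} → TIso f l l' → TIso f r r' → TIso f (nd l r) (nd l' r')
  swap : ∀ {l r l' r'} → TIso f l r' → TIso f r l' → TIso f (nd l r) (nd l' r')

TangleIso : {A B : Set} → BT A → BT A → BT B → BT B → Set
TangleIso {A} {B} l r l' r' = Σ (A → B) λ f → TIso f l l' × TIso f r r'

private
  a b c d : Fin 4
  a = zero
  b = suc zero
  c = suc (suc zero)
  d = suc (suc (suc zero))

-- 𝒦₁: matching l1r1=a, l2r3=b, l3r2=c, l4r4=d
K1-left K1-right : BT (Fin 4)
K1-left  = nd (nd (lf a) (lf b)) (nd (lf c) (lf d))
K1-right = nd (nd (lf a) (lf c)) (nd (lf b) (lf d))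

-- 𝒦₂: matching l1r4=a, l2r2=b, l3r3=c, l4r1=d
K2-left K2-right : BT (Fin 4)
K2-left  = nd (lf a) (nd (lf b) (nd (lf c) (lf d)))
K2-right = nd (lf d) (nd (lf b) (nd (lf c) (lf a)))

InducedIso : {n : ℕ} → Tanglegram n → Subset n → BT (Fin 4) → BT (Fin 4) → Set
InducedIso {n} T Z kl kr =
  Σ (BT (Fin n)) λ l → Σ (BT (Fin n)) λ r →
    restrict (lookup Z) (left T) ≡ just l ×
    restrict (lookup Z) (right T) ≡ just r ×
    TangleIso l r kl kr

CrossResponsible : {n : ℕ} → Tanglegram n → Subset n → Set
CrossResponsible T Y = InducedIso T Y K1-left K1-right ⊎ InducedIso T Y K2-left K2-right

leftScar rightScar : {n : ℕ} → Tanglegram n → Subset n → Fin n → Maybe Address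
leftScar  T Z m = scar (lookup Z) m (left T)
rightScar T Z m = scar (lookup Z) m (right T)

module Submission where

-- Suppose both scars of m lie inside 𝒯[X] ≅ 𝒦₁.  In either tree, m then hangs below the vertex where
-- the two cherries of the induced tree separate, on the side of one of them.  If x and y are the leaves
-- of that cherry, then on that side X − x + m selects exactly m and y, so it induces the same tree with
-- x renamed to m.  A cherry of the left tree of 𝒦₁ and a cherry of its right tree always share a
-- matching edge x; exchanging it for m gives a second cross-responsible set X − x + m ≠ X.

open import Defs
open import Data.Bool using (Bool; true; false; if_then_else_)
open import Data.Bool.ListAction using (any)
open import Data.Bool.Properties using (¬-not) renaming (_≟_ to _≟ᵇ_)
open import Data.Nat using (ℕ)
open import Data.Fin using (Fin)
open import Data.Fin.Patterns using (0F; 1F; 2F; 3F)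
open import Data.Fin.Properties using (_≟_)
open import Data.Fin.Subset using (Subset)
open import Data.Vec using (lookup; _[_]≔_)
open import Data.Vec.Properties using (lookup∘update; lookup∘update′)
open import Data.List using (List; []; _∷_; _++_; filter)
open import Data.List.Properties using (++-identityʳ; filter-++)
open import Data.List.Membership.Propositional using (_∈_; _∉_)
open import Data.List.Membership.Propositional.Properties
  using (∈-++⁺ˡ; ∈-++⁺ʳ; ∈-++⁻; ∈-filter⁺; ∈-filter⁻)
open import Data.List.Relation.Unary.Any using (here; there)
open import Data.List.Relation.Unary.All as All using ([]; _∷_)
open import Data.List.Relation.Unary.All.Properties using (++⁻ˡ; ++⁻ʳ)
open import Data.List.Relation.Unary.AllPairs using ([]; _∷_)
open import Data.List.Relation.Unary.Unique.Propositional using (Unique)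
open import Data.List.Relation.Binary.Disjoint.Propositional using (Disjoint)
open import Data.Maybe using (Maybe; just; nothing)
open import Data.Product using (∃; ∃₂; _×_; _,_; proj₁; proj₂)
open import Data.Empty using (⊥; ⊥-elim)
open import Data.Sum using (_⊎_; inj₁; inj₂)
import Data.Sum as Sum
open import Function using (_∘_)
open import Relation.Nullary using (Dec; does; yes; no; contradiction)
open import Relation.Nullary.Decidable using (⌊_⌋; isYes≗does; dec-true; dec-false)
open import Relation.Unary using (Decidable)
open import Relation.Binary.PropositionalEquality
  using (_≡_; _≢_; refl; sym; trans; cong; cong₂; subst; module ≡-Reasoning)
open ≡-Reasoning

private variable
  n : ℕ
  A B : Set
  x y z w m : A
  S S′ : Fin n → Bool
  t t′ u l r C P Q : BT A

Unique-++⁻ : (xs : List A) {ys : List A} →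
            Unique (xs ++ ys) → Unique xs × Unique ys × Disjoint xs ys
Unique-++⁻ []       u          = [] , u , λ { (() , _) }
Unique-++⁻ (x ∷ xs) (x∉ ∷ u) =
  let uxs , uys , disj = Unique-++⁻ xs u in
  ++⁻ˡ xs x∉ ∷ uxs , uys , λ where
    (here refl , x∈ys) → All.lookup (++⁻ʳ xs x∉) x∈ys refl
    (there v∈xs , v∈ys) → disj (v∈xs , v∈ys)

Disjoint⇒≢ : {xs ys : List A} → Disjoint xs ys → x ∈ xs → y ∈ ys → x ≢ y
Disjoint⇒≢ disj x∈ y∈ refl = disj (x∈ , y∈)

any-∈ : (p : A → Bool) {xs : List A} → x ∈ xs → p x ≡ true → any p xs ≡ true
any-∈ p (here refl) px rewrite px = refl
any-∈ p {y ∷ _} (there x∈) px with p y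
... | true  = refl
... | false = any-∈ p x∈ px

any-∉ : (p : A → Bool) (xs : List A) → (∀ {x} → x ∈ xs → p x ≡ false) → any p xs ≡ false
any-∉ p []       _    = refl
any-∉ p (x ∷ xs) none rewrite none (here refl) = any-∉ p xs (none ∘ there)

-- Cherries and isomorphisms of labelled trees

Cherry : BT A → A → A → Set
Cherry C x y = C ≡ nd (lf x) (lf y) ⊎ C ≡ nd (lf y) (lf x)

cherry-sym : Cherry C x y → Cherry C y x
cherry-sym = Sum.swap

cherry-∈ˡ : Cherry C x y → x ∈ leaves C
cherry-∈ˡ (inj₁ refl) = here refl
cherry-∈ˡ (inj₂ refl) = there (here refl)

cherry-∈ʳ : Cherry C x y → y ∈ leaves C
cherry-∈ʳ = cherry-∈ˡ ∘ cherry-sym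

cherry-∈⁻ : Cherry C x y → z ∈ leaves C → z ≡ x ⊎ z ≡ y
cherry-∈⁻ (inj₁ refl) (here refl)         = inj₁ refl
cherry-∈⁻ (inj₁ refl) (there (here refl)) = inj₂ refl
cherry-∈⁻ (inj₂ refl) (here refl)         = inj₂ refl
cherry-∈⁻ (inj₂ refl) (there (here refl)) = inj₁ refl

TIso-lf : {g : A → B} {b : B} → g x ≡ b → TIso g (lf x) (lf b)
TIso-lf {x = x} refl = lf x

TIso-id : {g : A → A} (t : BT A) → (∀ {z} → z ∈ leaves t → g z ≡ z) → TIso g t t
TIso-id (lf a)   fix = TIso-lf (fix (here refl))
TIso-id (nd l r) fix = nd (TIso-id l (fix ∘ ∈-++⁺ˡ)) (TIso-id r (fix ∘ ∈-++⁺ʳ (leaves l)))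

TIso-cherry : {g : A → B} {C : BT A} {C′ : BT B} {x′ y′ : B} →
              Cherry C x y → Cherry C′ x′ y′ → g x ≡ x′ → g y ≡ y′ → TIso g C C′
TIso-cherry (inj₁ refl) (inj₁ refl) gx gy = nd (TIso-lf gx) (TIso-lf gy)
TIso-cherry (inj₁ refl) (inj₂ refl) gx gy = swap (TIso-lf gx) (TIso-lf gy)
TIso-cherry (inj₂ refl) (inj₁ refl) gx gy = swap (TIso-lf gy) (TIso-lf gx)
TIso-cherry (inj₂ refl) (inj₂ refl) gx gy = nd (TIso-lf gy) (TIso-lf gx)

TIso-nd⁻ : {f : A → B} {P Q : BT B} → TIso f t (nd P Q) →
           ∃₂ λ t₁ t₂ → t ≡ nd t₁ t₂ ×
                        (TIso f t₁ P × TIso f t₂ Q ⊎ TIso f t₁ Q × TIso f t₂ P)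
TIso-nd⁻ (nd i₁ i₂)   = _ , _ , refl , inj₁ (i₁ , i₂)
TIso-nd⁻ (swap i₁ i₂) = _ , _ , refl , inj₂ (i₁ , i₂)

TIso-cherry⁻ : {f : A → B} {α β : B} → TIso f C (nd (lf α) (lf β)) →
               ∃₂ λ p q → Cherry C p q × f p ≡ α × f q ≡ β
TIso-cherry⁻ (nd (lf p) (lf q))   = p , q , inj₁ refl , refl , refl
TIso-cherry⁻ (swap (lf p) (lf q)) = q , p , inj₂ refl , refl , refl

TIso-∈ : {f : A → B} {K : BT B} → TIso f t K → z ∈ leaves t → f z ∈ leaves K
TIso-∈ (lf a) (here refl) = here refl
TIso-∈ {t = nd l₁ _} (nd i₁ i₂) z∈ with ∈-++⁻ (leaves l₁) z∈
... | inj₁ z∈₁ = ∈-++⁺ˡ (TIso-∈ i₁ z∈₁)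
... | inj₂ z∈₂ = ∈-++⁺ʳ _ (TIso-∈ i₂ z∈₂)
TIso-∈ {t = nd l₁ _} (swap i₁ i₂) z∈ with ∈-++⁻ (leaves l₁) z∈
... | inj₁ z∈₁ = ∈-++⁺ʳ _ (TIso-∈ i₁ z∈₁)
... | inj₂ z∈₂ = ∈-++⁺ˡ (TIso-∈ i₂ z∈₂)

mutual
  TIso-injective : {f : A → B} {K : BT B} → TIso f t K → Unique (leaves K) →
                   z ∈ leaves t → w ∈ leaves t → f z ≡ f w → z ≡ w
  TIso-injective (lf a) _ (here refl) (here refl) _ = refl
  TIso-injective (nd {l' = K₁} i₁ i₂) uK =
    let u₁ , u₂ , disj = Unique-++⁻ (leaves K₁) uK in TIso-injective-nd i₁ i₂ u₁ u₂ disj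
  TIso-injective (swap {l' = K₁} i₁ i₂) uK =
    let u₁ , u₂ , disj = Unique-++⁻ (leaves K₁) uK in
    TIso-injective-nd i₁ i₂ u₂ u₁ λ (p , q) → disj (q , p)

  TIso-injective-nd : {f : A → B} {K₁ K₂ : BT B} → TIso f l K₁ → TIso f r K₂ →
                      Unique (leaves K₁) → Unique (leaves K₂) → Disjoint (leaves K₁) (leaves K₂) →
                      z ∈ leaves (nd l r) → w ∈ leaves (nd l r) → f z ≡ f w → z ≡ w
  TIso-injective-nd {l = l} i₁ i₂ u₁ u₂ disj z∈ w∈ fz≡fw
    with ∈-++⁻ (leaves l) z∈ | ∈-++⁻ (leaves l) w∈
  ... | inj₁ z∈l | inj₁ w∈l = TIso-injective i₁ u₁ z∈l w∈l fz≡fw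
  ... | inj₂ z∈r | inj₂ w∈r = TIso-injective i₂ u₂ z∈r w∈r fz≡fw
  ... | inj₁ z∈l | inj₂ w∈r =
    contradiction fz≡fw (Disjoint⇒≢ disj (TIso-∈ i₁ z∈l) (TIso-∈ i₂ w∈r))
  ... | inj₂ z∈r | inj₁ w∈l =
    contradiction (sym fz≡fw) (Disjoint⇒≢ disj (TIso-∈ i₁ w∈l) (TIso-∈ i₂ z∈r))

TIso-transport : {g : A → A} {f f′ : A → B} {K : BT B} → TIso g t t′ → TIso f t K →
                 (∀ {z} → z ∈ leaves t → f′ (g z) ≡ f z) → TIso f′ t′ K
TIso-transport (lf a) (lf .a) h = TIso-lf (h (here refl))
TIso-transport {t = nd l₁ _} (nd i₁ i₂) (nd j₁ j₂) h =
  nd (TIso-transport i₁ j₁ (h ∘ ∈-++⁺ˡ))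
     (TIso-transport i₂ j₂ (h ∘ ∈-++⁺ʳ (leaves l₁)))
TIso-transport {t = nd l₁ _} (nd i₁ i₂) (swap j₁ j₂) h =
  swap (TIso-transport i₁ j₁ (h ∘ ∈-++⁺ˡ))
       (TIso-transport i₂ j₂ (h ∘ ∈-++⁺ʳ (leaves l₁)))
TIso-transport {t = nd l₁ _} (swap i₁ i₂) (nd j₁ j₂) h =
  swap (TIso-transport i₂ j₂ (h ∘ ∈-++⁺ʳ (leaves l₁)))
       (TIso-transport i₁ j₁ (h ∘ ∈-++⁺ˡ))
TIso-transport {t = nd l₁ _} (swap i₁ i₂) (swap j₁ j₂) h =
  nd (TIso-transport i₂ j₂ (h ∘ ∈-++⁺ʳ (leaves l₁)))
     (TIso-transport i₁ j₁ (h ∘ ∈-++⁺ˡ))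

-- Induced subtrees

nd? : Maybe (BT A) → Maybe (BT A) → Maybe (BT A)
nd? (just l) (just r) = just (nd l r)
nd? (just l) nothing  = just l
nd? nothing  r        = r

leaves? : Maybe (BT A) → List A
leaves? nothing  = []
leaves? (just t) = leaves t

restrict-nd : (S : Fin n → Bool) (l r : BT (Fin n)) →
              restrict S (nd l r) ≡ nd? (restrict S l) (restrict S r)
restrict-nd S l r with restrict S l | restrict S r
... | just _  | just _  = refl
... | just _  | nothing = refl
... | nothing | just _  = refl
... | nothing | nothing = refl

restrict-cong : (t : BT (Fin n)) → (∀ {z} → z ∈ leaves t → S z ≡ S′ z) →
                restrict S t ≡ restrict S′ t
restrict-cong (lf a) S≗S′ rewrite S≗S′ (here refl) = refl
restrict-cong {S = S} {S′ = S′} (nd l r) S≗S′ = begin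
  restrict S (nd l r)                   ≡⟨ restrict-nd S l r ⟩
  nd? (restrict S l) (restrict S r)     ≡⟨ cong₂ nd? (restrict-cong l (S≗S′ ∘ ∈-++⁺ˡ))
                                                     (restrict-cong r (S≗S′ ∘ ∈-++⁺ʳ (leaves l))) ⟩
  nd? (restrict S′ l) (restrict S′ r)   ≡⟨ restrict-nd S′ l r ⟨
  restrict S′ (nd l r)                  ∎

selected? : (S : Fin n → Bool) → Decidable (λ z → S z ≡ true)
selected? S z = S z ≟ᵇ true

restrict-leaves : (S : Fin n → Bool) (t : BT (Fin n)) →
                  leaves? (restrict S t) ≡ filter (selected? S) (leaves t)
restrict-leaves S (lf a) with S a
... | true  = refl
... | false = refl
restrict-leaves S (nd l r) = begin
  leaves? (restrict S (nd l r))                    ≡⟨ cong leaves? (restrict-nd S l r) ⟩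
  leaves? (nd? (restrict S l) (restrict S r))      ≡⟨ leaves?-nd? (restrict S l) (restrict S r) ⟩
  leaves? (restrict S l) ++ leaves? (restrict S r) ≡⟨ cong₂ _++_ (restrict-leaves S l)
                                                                 (restrict-leaves S r) ⟩
  filter S? (leaves l) ++ filter S? (leaves r)     ≡⟨ filter-++ S? (leaves l) (leaves r) ⟨
  filter S? (leaves (nd l r))                      ∎
  where
  leaves?-nd? : (a b : Maybe (BT A)) → leaves? (nd? a b) ≡ leaves? a ++ leaves? b
  leaves?-nd? (just l) (just r) = refl
  leaves?-nd? (just l) nothing  = sym (++-identityʳ (leaves l))
  leaves?-nd? nothing  b        = refl

  S? = selected? S

restrict-just-leaves : {t t′ : BT (Fin n)} → restrict S t ≡ just t′ →
                       leaves t′ ≡ filter (selected? S) (leaves t)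
restrict-just-leaves {S = S} {t = t} eq = trans (cong leaves? (sym eq)) (restrict-leaves S t)

restrict-∈⁻ : {t t′ : BT (Fin n)} → restrict S t ≡ just t′ →
              z ∈ leaves t′ → z ∈ leaves t × S z ≡ true
restrict-∈⁻ {S = S} {t = t} eq z∈ =
  ∈-filter⁻ (selected? S) (subst (_ ∈_) (restrict-just-leaves {t = t} eq) z∈)

restrict-∈⁺ : {t t′ : BT (Fin n)} → restrict S t ≡ just t′ →
              z ∈ leaves t → S z ≡ true → z ∈ leaves t′
restrict-∈⁺ {S = S} {t = t} eq z∈ Sz =
  subst (_ ∈_) (sym (restrict-just-leaves {t = t} eq)) (∈-filter⁺ (selected? S) z∈ Sz)

restrict-none⁻ : {t : BT (Fin n)} → restrict S t ≡ nothing → z ∈ leaves t → S z ≡ false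
restrict-none⁻ {S = S} {t = t} eq z∈ = ¬-not λ Sz →
  contradiction (subst (_ ∈_) (trans (sym (restrict-leaves S t)) (cong leaves? eq))
                                 (∈-filter⁺ (selected? S) z∈ Sz))
                λ ()

restrict-none : (t : BT (Fin n)) → (∀ {z} → z ∈ leaves t → S z ≢ true) →
                restrict S t ≡ nothing
restrict-none {S = S} (lf a) none with S a in Sa
... | true  = contradiction Sa (none (here refl))
... | false = refl
restrict-none {S = S} (nd l r) none
  rewrite restrict-nd S l r
        | restrict-none l (none ∘ ∈-++⁺ˡ)
        | restrict-none r (none ∘ ∈-++⁺ʳ (leaves l))
  = refl

restrict-single : (t : BT (Fin n)) → Unique (leaves t) → m ∈ leaves t → S m ≡ true →
                  (∀ {z} → z ∈ leaves t → S z ≡ true → z ≡ m) → restrict S t ≡ just (lf m)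
restrict-single (lf a) _ (here refl) Sm _ rewrite Sm = refl
restrict-single {S = S} (nd l r) u m∈ Sm only
  with Unique-++⁻ (leaves l) u | ∈-++⁻ (leaves l) m∈
... | ul , _ , disj | inj₁ m∈l
  rewrite restrict-nd S l r
        | restrict-single l ul m∈l Sm (only ∘ ∈-++⁺ˡ)
        | restrict-none r (λ z∈r Sz → Disjoint⇒≢ disj m∈l z∈r (sym (only (∈-++⁺ʳ _ z∈r) Sz)))
  = refl
... | _ , ur , disj | inj₂ m∈r
  rewrite restrict-nd S l r
        | restrict-none l (λ z∈l Sz → Disjoint⇒≢ disj z∈l m∈r (only (∈-++⁺ˡ z∈l) Sz))
        | restrict-single r ur m∈r Sm (only ∘ ∈-++⁺ʳ (leaves l))
  = refl

≡-resolveˡ : z ≡ x ⊎ z ≡ y → z ≢ y → z ≡ x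
≡-resolveˡ (inj₁ z≡x) _   = z≡x
≡-resolveˡ (inj₂ z≡y) z≢y = contradiction z≡y z≢y

restrict-split : (l r : BT (Fin n)) → Unique (leaves (nd l r)) →
                 m ∈ leaves l → y ∈ leaves r → S m ≡ true → S y ≡ true →
                 (∀ {z} → z ∈ leaves (nd l r) → S z ≡ true → z ≡ m ⊎ z ≡ y) →
                 restrict S (nd l r) ≡ just (nd (lf m) (lf y))
restrict-split {S = S} l r u m∈l y∈r Sm Sy only
  with ul , ur , disj ← Unique-++⁻ (leaves l) u
  rewrite restrict-nd S l r
        | restrict-single l ul m∈l Sm (λ z∈l Sz →
            ≡-resolveˡ (only (∈-++⁺ˡ z∈l) Sz) (Disjoint⇒≢ disj z∈l y∈r))
        | restrict-single r ur y∈r Sy (λ z∈r Sz →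
            ≡-resolveˡ (Sum.swap (only (∈-++⁺ʳ (leaves l) z∈r) Sz))
                       (Disjoint⇒≢ disj m∈l z∈r ∘ sym))
  = refl

restrict-pair : (t : BT (Fin n)) → Unique (leaves t) → m ∈ leaves t → y ∈ leaves t → m ≢ y →
                S m ≡ true → S y ≡ true →
                (∀ {z} → z ∈ leaves t → S z ≡ true → z ≡ m ⊎ z ≡ y) →
                ∃ λ C → restrict S t ≡ just C × Cherry C m y
restrict-pair (lf a) _ (here refl) (here refl) m≢y = contradiction refl m≢y
restrict-pair {S = S} (nd l r) u m∈ y∈ m≢y Sm Sy only
  with Unique-++⁻ (leaves l) u | ∈-++⁻ (leaves l) m∈ | ∈-++⁻ (leaves l) y∈
... | ul , _ , disj | inj₁ m∈l | inj₁ y∈l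
  with C , eC , cherry ← restrict-pair l ul m∈l y∈l m≢y Sm Sy (only ∘ ∈-++⁺ˡ)
  rewrite restrict-nd S l r | eC
        | restrict-none r (λ z∈r Sz →
            Sum.[ Disjoint⇒≢ disj m∈l z∈r ∘ sym , Disjoint⇒≢ disj y∈l z∈r ∘ sym ]
                (only (∈-++⁺ʳ _ z∈r) Sz))
  = C , refl , cherry
... | _ , ur , disj | inj₂ m∈r | inj₂ y∈r
  with C , eC , cherry ← restrict-pair r ur m∈r y∈r m≢y Sm Sy (only ∘ ∈-++⁺ʳ (leaves l))
  rewrite restrict-nd S l r | eC
        | restrict-none l (λ z∈l Sz →
            Sum.[ Disjoint⇒≢ disj z∈l m∈r , Disjoint⇒≢ disj z∈l y∈r ]
                (only (∈-++⁺ˡ z∈l) Sz))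
  = C , refl , cherry
... | _ | inj₁ m∈l | inj₂ y∈r = _ , restrict-split l r u m∈l y∈r Sm Sy only , inj₁ refl
... | _ | inj₂ m∈r | inj₁ y∈l =
  _ , restrict-split l r u y∈l m∈r Sy Sm (λ z∈ Sz → Sum.swap (only z∈ Sz)) , inj₂ refl

-- Scars

some-leaf : (t : BT A) → ∃ λ z → z ∈ leaves t
some-leaf (lf a)   = a , here refl
some-leaf (nd l r) = let z , z∈ = some-leaf l in z , ∈-++⁺ˡ z∈

occurs-∈ : {t : BT (Fin n)} → w ∈ leaves t → occurs w t ≡ true
occurs-∈ {w = w} w∈ =
  any-∈ (λ z → ⌊ z ≟ w ⌋) w∈ (trans (isYes≗does (w ≟ w)) (dec-true (w ≟ w) refl))

occurs-∉ : (t : BT (Fin n)) → w ∉ leaves t → occurs w t ≡ false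
occurs-∉ {w = w} t w∉ = any-∉ _ (leaves t) λ {z} z∈ →
  trans (isYes≗does (z ≟ w)) (dec-false (z ≟ w) λ { refl → w∉ z∈ })

hasS-just : {t t′ : BT (Fin n)} → restrict S t ≡ just t′ → hasS S t ≡ true
hasS-just {S = S} {t = t} {t′ = t′} eq =
  let z , z∈ = some-leaf t′ ; z∈t , Sz = restrict-∈⁻ {t = t} eq z∈ in any-∈ S z∈t Sz

hasS-nothing : {t : BT (Fin n)} → restrict S t ≡ nothing → hasS S t ≡ false
hasS-nothing {S = S} {t = t} eq = any-∉ S (leaves t) (restrict-none⁻ {t = t} eq)

module _ {P : BT (Fin n)} (l r : BT (Fin n))
         (el : restrict S l ≡ just P) (er : restrict S r ≡ nothing) where

  scar-suppressedˡ-outside : w ∈ leaves r → scar S w (nd l r) ≡ just []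
  scar-suppressedˡ-outside w∈r
    rewrite hasS-just {t = l} el | hasS-nothing {t = r} er | occurs-∈ {t = r} w∈r = refl

  scar-suppressedˡ : w ∉ leaves r → scar S w (nd l r) ≡ scar S w l
  scar-suppressedˡ w∉r
    rewrite hasS-just {t = l} el | hasS-nothing {t = r} er | occurs-∉ r w∉r = refl

module _ {Q : BT (Fin n)} (l r : BT (Fin n))
         (el : restrict S l ≡ nothing) (er : restrict S r ≡ just Q) where

  scar-suppressedʳ-outside : w ∈ leaves l → scar S w (nd l r) ≡ just []
  scar-suppressedʳ-outside w∈l
    rewrite hasS-nothing {t = l} el | hasS-just {t = r} er | occurs-∈ {t = l} w∈l = refl

  scar-suppressedʳ : w ∉ leaves l → scar S w (nd l r) ≡ scar S w r
  scar-suppressedʳ w∉l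
    rewrite hasS-nothing {t = l} el | hasS-just {t = r} er | occurs-∉ l w∉l = refl

-- Exchanging a selected leaf for an unselected one

record Exchange (S S′ : Fin n → Bool) (x m : Fin n) : Set where
  field
    x∈S       : S x ≡ true
    m∉S       : S m ≡ false
    x∉S′      : S′ x ≡ false
    m∈S′      : S′ m ≡ true
    unchanged : ∀ {z} → z ≢ x → z ≢ m → S′ z ≡ S z

exchange-update : (X : Subset n) → lookup X x ≡ true → lookup X m ≡ false →
                  Exchange (lookup X) (lookup ((X [ x ]≔ false) [ m ]≔ true)) x m
exchange-update {x = x} {m = m} X Xx Xm = record
  { x∈S       = Xx
  ; m∉S       = Xm
  ; x∉S′      = trans (lookup∘update′ x≢m (X [ x ]≔ false) true) (lookup∘update x X false)
  ; m∈S′      = lookup∘update m (X [ x ]≔ false) true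
  ; unchanged = λ z≢x z≢m →
      trans (lookup∘update′ z≢m (X [ x ]≔ false) true) (lookup∘update′ z≢x X false)
  }
  where
  x≢m : x ≢ m
  x≢m refl = contradiction (trans (sym Xx) Xm) λ ()

rename : Fin n → Fin n → Fin n → Fin n
rename x m z = if does (z ≟ x) then m else z

rename-here : rename x m x ≡ m
rename-here {x = x} rewrite dec-true (x ≟ x) refl = refl

rename-other : z ≢ x → rename x m z ≡ z
rename-other {z = z} {x = x} z≢x rewrite dec-false (z ≟ x) z≢x = refl

rename-cancel : z ≢ m → rename m x (rename x m z) ≡ z
rename-cancel {z = z} {m = m} {x = x} z≢m with z ≟ x
... | yes refl = rename-here {x = m}
... | no _     = rename-other z≢m

Exchangeable : (S : Fin n → Bool) (u t : BT (Fin n)) (x m : Fin n) → Set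
Exchangeable S u t x m =
  ∀ {S′} → Exchange S S′ x m → ∃ λ t′ → restrict S′ u ≡ just t′ × TIso (rename x m) t t′

CherryExchangeable : (S : Fin n → Bool) (u t C : BT (Fin n)) (m : Fin n) → Set
CherryExchangeable S u t C m = ∀ {x y} → x ≢ y → Cherry C x y → Exchangeable S u t x m

module _ {x m : Fin n} (ex : Exchange S S′ x m) where
  open Exchange ex

  exchange-apart : (t : BT (Fin n)) → x ∉ leaves t → m ∉ leaves t → restrict S′ t ≡ restrict S t
  exchange-apart t x∉ m∉ =
    restrict-cong t λ z∈ → unchanged (λ { refl → x∉ z∈ }) (λ { refl → m∉ z∈ })

  exchange-apart-iso : (t : BT (Fin n)) → x ∉ leaves t → m ∉ leaves t → restrict S t ≡ just Q →
                       restrict S′ t ≡ just Q × TIso (rename x m) Q Q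
  exchange-apart-iso {Q = Q} t x∉ m∉ eq =
    trans (exchange-apart t x∉ m∉) eq ,
    TIso-id Q λ z∈ → rename-other λ { refl → x∉ (proj₁ (restrict-∈⁻ {t = t} eq z∈)) }

  cherry-exchange : (u : BT (Fin n)) → Unique (leaves u) → restrict S u ≡ just C → m ∈ leaves u →
                    x ≢ y → Cherry C x y →
                    ∃ λ C′ → restrict S′ u ≡ just C′ × TIso (rename x m) C C′
  cherry-exchange {y = y} u uu eq m∈ x≢y cxy =
    let C′ , eC′ , cmy = restrict-pair u uu m∈ y∈u m≢y m∈S′ S′y only in
    C′ , eC′ , TIso-cherry cxy cmy (rename-here {x = x}) (rename-other (x≢y ∘ sym))
    where
    y∈u : y ∈ leaves u
    y∈u = proj₁ (restrict-∈⁻ {t = u} eq (cherry-∈ʳ cxy))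
    Sy : S y ≡ true
    Sy = proj₂ (restrict-∈⁻ {t = u} eq (cherry-∈ʳ cxy))
    m≢y : m ≢ y
    m≢y refl = contradiction (trans (sym Sy) m∉S) λ ()
    S′y : S′ y ≡ true
    S′y = trans (unchanged (x≢y ∘ sym) (m≢y ∘ sym)) Sy
    only : ∀ {z} → z ∈ leaves u → S′ z ≡ true → z ≡ m ⊎ z ≡ y
    only {z} z∈ S′z with z ≟ x | z ≟ m
    ... | yes refl | _        = contradiction (trans (sym S′z) x∉S′) λ ()
    ... | no _     | yes z≡m  = inj₁ z≡m
    ... | no z≢x   | no z≢m
      with cherry-∈⁻ cxy (restrict-∈⁺ {t = u} eq z∈ (trans (sym (unchanged z≢x z≢m)) S′z))
    ...   | inj₁ z≡x = contradiction z≡x z≢x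
    ...   | inj₂ z≡y = inj₂ z≡y

exchangeable-suppressedˡ : (l r : BT (Fin n)) → restrict S r ≡ nothing → m ∉ leaves r →
                           Exchangeable S l t x m → Exchangeable S (nd l r) t x m
exchangeable-suppressedˡ {S = S} {x = x} l r er m∉r exchangeable {S′} ex =
  let t′ , et′ , iso = exchangeable ex in
  t′ , trans (restrict-nd S′ l r) (cong₂ nd? et′ (trans (exchange-apart ex r x∉r m∉r) er)) , iso
  where
  x∉r : x ∉ leaves r
  x∉r x∈r = contradiction (trans (sym (Exchange.x∈S ex)) (restrict-none⁻ {t = r} er x∈r)) λ ()

exchangeable-suppressedʳ : (l r : BT (Fin n)) → restrict S l ≡ nothing → m ∉ leaves l →
                           Exchangeable S r t x m → Exchangeable S (nd l r) t x m
exchangeable-suppressedʳ {S = S} {x = x} l r el m∉l exchangeable {S′} ex =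
  let t′ , et′ , iso = exchangeable ex in
  t′ , trans (restrict-nd S′ l r) (cong₂ nd? (trans (exchange-apart ex l x∉l m∉l) el) et′) , iso
  where
  x∉l : x ∉ leaves l
  x∉l x∈l = contradiction (trans (sym (Exchange.x∈S ex)) (restrict-none⁻ {t = l} el x∈l)) λ ()

module _ {P Q : BT (Fin n)} (l r : BT (Fin n)) (u : Unique (leaves (nd l r)))
         (el : restrict S l ≡ just P) (er : restrict S r ≡ just Q) where

  split-exchangeˡ : m ∈ leaves l → CherryExchangeable S (nd l r) (nd P Q) P m
  split-exchangeˡ {m = m} m∈l x≢y cxy {S′} ex =
    let ul , _ , disj = Unique-++⁻ (leaves l) u
        C′ , eC′ , iso = cherry-exchange ex l ul el m∈l x≢y cxy
        x∉r = λ x∈r → disj (proj₁ (restrict-∈⁻ {t = l} el (cherry-∈ˡ cxy)) , x∈r)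
        eQ , isoQ = exchange-apart-iso ex r x∉r (λ m∈r → disj (m∈l , m∈r)) er
    in nd C′ Q , trans (restrict-nd S′ l r) (cong₂ nd? eC′ eQ) , nd iso isoQ

  split-exchangeʳ : m ∈ leaves r → CherryExchangeable S (nd l r) (nd P Q) Q m
  split-exchangeʳ {m = m} m∈r x≢y cxy {S′} ex =
    let _ , ur , disj = Unique-++⁻ (leaves l) u
        C′ , eC′ , iso = cherry-exchange ex r ur er m∈r x≢y cxy
        x∉l = λ x∈l → disj (x∈l , proj₁ (restrict-∈⁻ {t = r} er (cherry-∈ˡ cxy)))
        eP , isoP = exchange-apart-iso ex l x∉l (λ m∈l → disj (m∈l , m∈r)) el
    in nd P C′ , trans (restrict-nd S′ l r) (cong₂ nd? eP eC′) , nd isoP iso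

inside-scar-exchange : (u : BT (Fin n)) → Unique (leaves u) → restrict S u ≡ just (nd P Q) →
                       m ∈ leaves u → scar S m u ≢ just [] →
                       CherryExchangeable S u (nd P Q) P m ⊎ CherryExchangeable S u (nd P Q) Q m
inside-scar-exchange {S = S} (lf a) _ eq _ _ with S a | eq
... | true  | ()
... | false | ()
inside-scar-exchange {S = S} {m = m} (nd l r) u eq m∈ inside
  with restrict S l in el | restrict S r in er | trans (sym (restrict-nd S l r)) eq
     | Unique-++⁻ (leaves l) u | ∈-++⁻ (leaves l) m∈
... | just _  | just _  | refl | _ | inj₁ m∈l = inj₁ (split-exchangeˡ l r u el er m∈l)
... | just _  | just _  | refl | _ | inj₂ m∈r = inj₂ (split-exchangeʳ l r u el er m∈r)
... | just _  | nothing | refl | _ | inj₂ m∈r =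
  contradiction (scar-suppressedˡ-outside l r el er m∈r) inside
... | just _  | nothing | refl | ul , _ , disj | inj₁ m∈l =
  Sum.map lift lift (inside-scar-exchange l ul el m∈l (inside ∘ trans (scar-suppressedˡ l r el er m∉r)))
  where
  m∉r : m ∉ leaves r
  m∉r m∈r = disj (m∈l , m∈r)
  lift : ∀ {t C} → CherryExchangeable S l t C m → CherryExchangeable S (nd l r) t C m
  lift exchangeable x≢y cxy = exchangeable-suppressedˡ l r er m∉r (exchangeable x≢y cxy)
... | nothing | just _  | refl | _ | inj₁ m∈l =
  contradiction (scar-suppressedʳ-outside l r el er m∈l) inside
... | nothing | just _  | refl | _ , ur , disj | inj₂ m∈r =
  Sum.map lift lift (inside-scar-exchange r ur er m∈r (inside ∘ trans (scar-suppressedʳ l r el er m∉l)))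
  where
  m∉l : m ∉ leaves l
  m∉l m∈l = disj (m∈l , m∈r)
  lift : ∀ {t C} → CherryExchangeable S r t C m → CherryExchangeable S (nd l r) t C m
  lift exchangeable x≢y cxy = exchangeable-suppressedʳ l r el m∉l (exchangeable x≢y cxy)
... | nothing | nothing | () | _ | _

ExchangeableAt : (S : Fin n → Bool) (f : Fin n → B) (u t : BT (Fin n)) (m : Fin n) (k : B) → Set
ExchangeableAt S f u t m k = ∃ λ x → f x ≡ k × x ∈ leaves t × Exchangeable S u t x m

cherry-exchangeable-at : {f : Fin n → B} {α β : B} → TIso f C (nd (lf α) (lf β)) → α ≢ β →
                         (∀ {z} → z ∈ leaves C → z ∈ leaves t) → CherryExchangeable S u t C m →
                         ExchangeableAt S f u t m α × ExchangeableAt S f u t m β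
cherry-exchangeable-at iso α≢β C⊆t exchangeable with p , q , cpq , fp , fq ← TIso-cherry⁻ iso =
  (p , fp , C⊆t (cherry-∈ˡ cpq) , exchangeable p≢q cpq) ,
  (q , fq , C⊆t (cherry-∈ʳ cpq) , exchangeable (p≢q ∘ sym) (cherry-sym cpq))
  where
  p≢q : p ≢ q
  p≢q refl = α≢β (trans (sym fp) fq)

inside-scar-exchangeable-at :
  {f : Fin n → B} {α β γ δ : B} (u : BT (Fin n)) → Unique (leaves u) → restrict S u ≡ just t →
  TIso f t (nd (nd (lf α) (lf β)) (nd (lf γ) (lf δ))) → α ≢ β → γ ≢ δ →
  m ∈ leaves u → scar S m u ≢ just [] →
  let At = ExchangeableAt S f u t m in At α × At β ⊎ At γ × At δ
inside-scar-exchangeable-at u uu eq iso α≢β γ≢δ m∈ inside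
  with P , Q , refl , orientation ← TIso-nd⁻ iso
  with inside-scar-exchange u uu eq m∈ inside | orientation
... | inj₁ atP | inj₁ (isoP , _) = inj₁ (cherry-exchangeable-at {u = u} isoP α≢β ∈-++⁺ˡ atP)
... | inj₂ atQ | inj₁ (_ , isoQ) = inj₂ (cherry-exchangeable-at {u = u} isoQ γ≢δ (∈-++⁺ʳ _) atQ)
... | inj₁ atP | inj₂ (isoP , _) = inj₂ (cherry-exchangeable-at {u = u} isoP γ≢δ ∈-++⁺ˡ atP)
... | inj₂ atQ | inj₂ (_ , isoQ) = inj₁ (cherry-exchangeable-at {u = u} isoQ α≢β (∈-++⁺ʳ _) atQ)

K1-cherries-meet : {F G : Fin 4 → Set} →
                   F 0F × F 1F ⊎ F 2F × F 3F → G 0F × G 2F ⊎ G 1F × G 3F → ∃ λ k → F k × G k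
K1-cherries-meet (inj₁ (f₀ , _)) (inj₁ (g₀ , _)) = 0F , f₀ , g₀
K1-cherries-meet (inj₁ (_ , f₁)) (inj₂ (g₁ , _)) = 1F , f₁ , g₁
K1-cherries-meet (inj₂ (f₂ , _)) (inj₁ (_ , g₂)) = 2F , f₂ , g₂
K1-cherries-meet (inj₂ (_ , f₃)) (inj₂ (_ , g₃)) = 3F , f₃ , g₃

-- Tanglegrams

module _ (T : Tanglegram n) (X : Subset n) (eL : restrict (lookup X) (left T) ≡ just l)
         (eR : restrict (lookup X) (right T) ≡ just r) where

  exchangeable-at-both : {kl : BT B} {f : Fin n → B} {k : B} → TIso f l kl → Unique (leaves kl) →
    ExchangeableAt (lookup X) f (left T) l m k → ExchangeableAt (lookup X) f (right T) r m k →
    ∃ λ x → lookup X x ≡ true ×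
            Exchangeable (lookup X) (left T) l x m × Exchangeable (lookup X) (right T) r x m
  exchangeable-at-both isoL ukl (x , fx , x∈l , exL) (x′ , fx′ , x′∈r , exR)
    with x′∈l ← restrict-∈⁺ {t = left T} eL (proj₂ (left-ok T) x′)
                                            (proj₂ (restrict-∈⁻ {t = right T} eR x′∈r))
    with refl ← TIso-injective isoL ukl x∈l x′∈l (trans fx (sym fx′))
    = x , proj₂ (restrict-∈⁻ {t = left T} eL x∈l) , exL , exR

  exchange-induced-iso : {kl kr : BT (Fin 4)} {f : Fin n → Fin 4} → TIso f l kl → TIso f r kr →
    lookup X x ≡ true → lookup X m ≡ false →
    Exchangeable (lookup X) (left T) l x m → Exchangeable (lookup X) (right T) r x m →
    ∃ λ Y → lookup Y m ≡ true × InducedIso T Y kl kr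
  exchange-induced-iso {x = x} {m = m} {f = f} isoL isoR Xx Xm exL exR =
    let ex = exchange-update X Xx Xm
        l′ , eL′ , renameL = exL ex
        r′ , eR′ , renameR = exR ex
    in (X [ x ]≔ false) [ m ]≔ true , Exchange.m∈S′ ex ,
       l′ , r′ , eL′ , eR′ , f ∘ rename m x ,
       TIso-transport renameL isoL (undo (left T) eL) , TIso-transport renameR isoR (undo (right T) eR)
    where
    undo : ∀ u {t} → restrict (lookup X) u ≡ just t →
           ∀ {z} → z ∈ leaves t → f (rename m x (rename x m z)) ≡ f z
    undo u eq z∈ = cong f (rename-cancel λ { refl →
      contradiction (trans (sym (proj₂ (restrict-∈⁻ {t = u} eq z∈))) Xm) λ () })

K1-left-unique : Unique (leaves K1-left)
K1-left-unique = ((λ ()) ∷ (λ ()) ∷ (λ ()) ∷ []) ∷ ((λ ()) ∷ (λ ()) ∷ []) ∷ ((λ ()) ∷ []) ∷ [] ∷ []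

inside-scars-K1-impossible : (T : Tanglegram n) (X : Subset n) → (∀ Y → CrossResponsible T Y → Y ≡ X) →
  InducedIso T X K1-left K1-right → lookup X m ≡ false →
  leftScar T X m ≢ just [] → rightScar T X m ≢ just [] → ⊥
inside-scars-K1-impossible {m = m} T X unique (l , r , eL , eR , f , isoL , isoR) Xm insideL insideR =
  let k , atL , atR = K1-cherries-meet {F = AtLeft} {G = AtRight}
        (inside-scar-exchangeable-at (left T) (proj₁ (left-ok T)) eL isoL (λ ()) (λ ())
                                     (proj₂ (left-ok T) m) insideL)
        (inside-scar-exchangeable-at (right T) (proj₁ (right-ok T)) eR isoR (λ ()) (λ ())
                                     (proj₂ (right-ok T) m) insideR)
      x , Xx , exL , exR = exchangeable-at-both T X eL eR isoL K1-left-unique atL atR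
      Y , m∈Y , isoY = exchange-induced-iso T X eL eR isoL isoR Xx Xm exL exR
  in contradiction (trans (sym Xm) (subst (λ Z → lookup Z m ≡ true) (unique Y (inj₁ isoY)) m∈Y)) λ ()
  where
  AtLeft AtRight : Fin 4 → Set
  AtLeft  = ExchangeableAt (lookup X) f (left T) l m
  AtRight = ExchangeableAt (lookup X) f (right T) r m

outside? : (s : Maybe Address) → Dec (IsOutside s)
outside? nothing        = no λ ()
outside? (just [])      = yes refl
outside? (just (_ ∷ _)) = no λ ()

lemma5 : {n : ℕ} (T : Tanglegram n) (X : Subset n) →
         CrossResponsible T X →
         (∀ Y → CrossResponsible T Y → Y ≡ X) →
         InducedIso T X K1-left K1-right →
         ∀ (m : Fin n) → lookup X m ≡ false →
         IsOutside (leftScar T X m) ⊎ IsOutside (rightScar T X m)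
lemma5 T X _ unique isoK1 m Xm with outside? (leftScar T X m) | outside? (rightScar T X m)
... | yes outsideL | _            = inj₁ outsideL
... | no _         | yes outsideR = inj₂ outsideR
... | no insideL   | no insideR   =
  ⊥-elim (inside-scars-K1-impossible T X unique isoK1 Xm insideL insideR)
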